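{- Let $X$ be a finite set and let $\preceq$ be a supermodular weak order on $2^X$. For each $A\subseteq X$ let $A^*$ be the unique subset satisfying: (a) $A^*\subseteq A$; (b) $B\subseteq A$ implies $B\preceq A^*$; (c) if $A^*\preceq B\subseteq A$ then $A^*\subseteq B$. Then the choice function $f$ on $X$ defined by $f(A)=A^*$ is complementary.
   Context: A weak order on $2^X$ is a complete preorder $\preceq$; $\prec$ denotes its strict part. It is called supermodular if for all $A,B\subseteq X$: either $A\preceq A\cap B$ or $B\preceq A\cup B$, and if $A\cap B\prec A$ then $B\prec A\cup B$. For such an order and every $A\subseteq X$ there exists a unique $A^*$ with properties (a)–(c). A choice function (CF) on $X$ is a map $f:2^X\to 2^X$ with $f(A)\subseteq A$; it is consistent if $f(A)\subseteq B\subseteq A$ implies $f(B)=f(A)$; monotonic if $A\subseteq B$ implies $f(A)\subseteq f(B)$; complementary if consistent and monotonic. -}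

module Defs where

open import Level using (Level; _⊔_; suc)
open import Data.Nat using (ℕ)
open import Data.Fin.Subset using (Subset; _⊆_; _∩_; _∪_)
open import Data.Product using (_×_)
open import Data.Sum using (_⊎_)
open import Relation.Nullary using (¬_)
open import Relation.Binary.PropositionalEquality using (_≡_)

-- The ground set X is Fin n; 2^X is Subset n.

record IsWeakOrder {ℓ : Level} {n : ℕ} (_≼_ : Subset n → Subset n → Set ℓ) : Set ℓ where
  field
    refl′  : ∀ A → A ≼ A
    trans′ : ∀ {A B C} → A ≼ B → B ≼ C → A ≼ C
    total  : ∀ A B → (A ≼ B) ⊎ (B ≼ A)

Strict : {ℓ : Level} {n : ℕ} → (Subset n → Subset n → Set ℓ) → Subset n → Subset n → Set ℓ
Strict _≼_ A B = (A ≼ B) × ¬ (B ≼ A)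

IsSupermodular : {ℓ : Level} {n : ℕ} (_≼_ : Subset n → Subset n → Set ℓ) → Set ℓ
IsSupermodular {n = n} _≼_ =
  ∀ (A B : Subset n) →
    ((A ≼ (A ∩ B)) ⊎ (B ≼ (A ∪ B)))
    × (Strict _≼_ (A ∩ B) A → Strict _≼_ B (A ∪ B))

IsStar : {ℓ : Level} {n : ℕ} (_≼_ : Subset n → Subset n → Set ℓ) → Subset n → Subset n → Set ℓ
IsStar {n = n} _≼_ A S =
  (S ⊆ A)
  × (∀ (B : Subset n) → B ⊆ A → B ≼ S)
  × (∀ (B : Subset n) → S ≼ B → B ⊆ A → S ⊆ B)

ChoiceFunction : ℕ → Set
ChoiceFunction n = Subset n → Subset n

IsCF : {n : ℕ} → ChoiceFunction n → Set
IsCF {n} f = ∀ (A : Subset n) → f A ⊆ A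

Consistent : {n : ℕ} → ChoiceFunction n → Set
Consistent {n} f = ∀ (A B : Subset n) → f A ⊆ B → B ⊆ A → f B ≡ f A

Monotonic : {n : ℕ} → ChoiceFunction n → Set
Monotonic {n} f = ∀ (A B : Subset n) → A ⊆ B → f A ⊆ f B

Complementary : {n : ℕ} → ChoiceFunction n → Set
Complementary f = Consistent f × Monotonic f

-- Consistency uses only the defining properties (b) and (c) of A*.  For
-- monotonicity, let A ⊆ B and x ∈ A* ∖ B*.  Then A* ∩ B* ≺ A*, since otherwise
-- (c) would give A* ⊆ A* ∩ B*; supermodularity yields B* ≺ A* ∪ B*, contradicting
-- (b) for B because A* ∪ B* ⊆ B.
module Submission where

open import Defs
open import Level using (Level)
open import Data.Nat using (ℕ)
open import Data.Fin.Subset using (Subset; _⊆_; _∩_; _∪_)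
open import Data.Fin.Subset.Properties using (_∈?_; ⊆-antisym; ⊆-trans; p∩q⊆p; p∩q⊆q; x∈p∪q⁻)
open import Data.Product using (_,_; proj₁; proj₂)
open import Data.Sum using ([_,_])
open import Data.Empty using (⊥-elim)
open import Relation.Nullary using (yes; no)
open import Relation.Binary.PropositionalEquality using (_≡_)

module _ {ℓ : Level} {n : ℕ} (_≼_ : Subset n → Subset n → Set ℓ) where

  module _ {A S : Subset n} (star : IsStar _≼_ A S) where

    star-⊆ : S ⊆ A
    star-⊆ = proj₁ star

    star-greatest : ∀ B → B ⊆ A → B ≼ S
    star-greatest = proj₁ (proj₂ star)

    star-least : ∀ B → S ≼ B → B ⊆ A → S ⊆ B
    star-least = proj₂ (proj₂ star)

  star-consistent : ∀ {A B S T} → IsStar _≼_ A S → IsStar _≼_ B T →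
                    S ⊆ B → B ⊆ A → T ≡ S
  star-consistent {S = S} {T} starA starB S⊆B B⊆A =
    ⊆-antisym (star-least starB S (star-greatest starA T T⊆A) S⊆B)
              (star-least starA T (star-greatest starB S S⊆B) T⊆A)
    where
    T⊆A = ⊆-trans (star-⊆ starB) B⊆A

  star-monotone : (∀ C D → Strict _≼_ (C ∩ D) C → Strict _≼_ D (C ∪ D)) →
                  ∀ {A B S T} → IsStar _≼_ A S → IsStar _≼_ B T →
                  A ⊆ B → S ⊆ T
  star-monotone super {A} {B} {S} {T} starA starB A⊆B {x} x∈S with x ∈? T
  ... | yes x∈T = x∈T
  ... | no x∉T = ⊥-elim (proj₂ T≺S∪T (star-greatest starB (S ∪ T) S∪T⊆B))
    where
    S∩T⊆A : S ∩ T ⊆ A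
    S∩T⊆A = ⊆-trans (p∩q⊆p S T) (star-⊆ starA)

    S∩T≺S : Strict _≼_ (S ∩ T) S
    S∩T≺S = star-greatest starA (S ∩ T) S∩T⊆A
          , λ S≼S∩T → x∉T (p∩q⊆q S T (star-least starA (S ∩ T) S≼S∩T S∩T⊆A x∈S))

    T≺S∪T : Strict _≼_ T (S ∪ T)
    T≺S∪T = super S T S∩T≺S

    S∪T⊆B : S ∪ T ⊆ B
    S∪T⊆B y∈S∪T = [ (λ y∈S → A⊆B (star-⊆ starA y∈S)) , star-⊆ starB ]
                    (x∈p∪q⁻ S T y∈S∪T)

proposition6 : {ℓ : Level} (n : ℕ) (_≼_ : Subset n → Subset n → Set ℓ) →
    IsWeakOrder _≼_ → IsSupermodular _≼_ →
    (f : ChoiceFunction n) → (∀ (A : Subset n) → IsStar _≼_ A (f A)) →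
    Complementary f
proposition6 n _≼_ _ super f star =
    (λ A B fA⊆B B⊆A → star-consistent _≼_ (star A) (star B) fA⊆B B⊆A)
  , (λ A B A⊆B → star-monotone _≼_ (λ C D → proj₂ (super C D)) (star A) (star B) A⊆B)
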